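{- Let $K$ be a global field, $L_1,\dots,L_n$ finite separable field extensions of $K$, $L$ the Galois closure of $L_1\cdots L_n$, $G=\mathrm{Gal}(L/K)$, $G^{(i)}=\mathrm{Gal}(L/L_i)$, $G^\vee=\mathrm{Hom}(G,\mathbb{Q}/\mathbb{Z})$. Let $\Lambda=\mathbf{X}^*(\mathbf{T})$ and let $e:H^2(G,\mathbb{Z})\to H^2(G,\Lambda)$ be the map induced by the injection $\mathbb{Z}\to\Lambda$ dual to the projection $\mathbf{T}\to\mathbb{G}_m$, $(x,y_1,\dots,y_n)\mapsto x$. Identifying $H^2(G,\mathbb{Z})\cong G^\vee$, we have $$\mathrm{Ker}\,e=\Big\{f\in G^\vee:\ \text{there exist }f_1,\dots,f_n\in G^\vee\text{ with }f_i|_{G^{(i)}}\equiv0\text{ for all }i\text{ and }f=\textstyle\sum_i f_i\Big\}.$$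
   Context: $\mathbf{T}$ is the $K$-torus defined as the kernel of $\mathbb{G}_m\times\prod_i\mathrm{R}_{L_i/K}\mathbb{G}_m\to\mathbb{G}_m^n$, $(x,y_1,\dots,y_n)\mapsto(x^{ -1}N_{L_i/K}(y_i))_i$, with $\mathrm{R}$ Weil restriction; $\mathbf{X}^*(\mathbf{T})$ is its character lattice as a $G$-module. Concretely $\Lambda\cong(\bigoplus_i\mathbb{Z}[G/G^{(i)}])/\{(\lambda_1d_1,\dots,\lambda_nd_n):\lambda_i\in\mathbb{Z},\sum\lambda_i=0\}$ with $d_i$ the sum of all cosets in $G/G^{(i)}$, and $\mathbb{Z}\to\Lambda$ sends $1$ to the class of $(d_1,0,\dots,0)$. The identification $H^2(G,\mathbb{Z})\cong G^\vee$ is the standard one via $H^1(G,\mathbb{Q}/\mathbb{Z})$. -}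

module Defs where

open import Data.Nat using (ℕ; zero; suc)
open import Data.Fin using (Fin; zero; suc)
open import Data.Integer as ℤ using (ℤ)
open import Data.Rational as ℚ using (ℚ; _/_)
open import Data.Product using (Σ; ∃; _×_; _,_)
open import Relation.Binary.PropositionalEquality using (_≡_)

record FinGroup : Set where
  infixl 7 _∙_
  field
    N     : ℕ
    _∙_   : Fin N → Fin N → Fin N
    ε     : Fin N
    _⁻¹   : Fin N → Fin N
    assoc     : ∀ x y z → (x ∙ y) ∙ z ≡ x ∙ (y ∙ z)
    identityˡ : ∀ x → ε ∙ x ≡ x
    identityʳ : ∀ x → x ∙ ε ≡ x
    inverseˡ  : ∀ x → (x ⁻¹) ∙ x ≡ ε
    inverseʳ  : ∀ x → x ∙ (x ⁻¹) ≡ ε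

record Subgroup (G : FinGroup) : Set₁ where
  open FinGroup G
  field
    mem     : Fin N → Set
    ε-mem   : mem ε
    ∙-mem   : ∀ {x y} → mem x → mem y → mem (x ∙ y)
    ⁻¹-mem  : ∀ {x} → mem x → mem (x ⁻¹)

sumℤ : ∀ {k} → (Fin k → ℤ) → ℤ
sumℤ {zero}  f = ℤ.0ℤ
sumℤ {suc k} f = f zero ℤ.+ sumℤ (λ i → f (suc i))

sumℚ : ∀ {k} → (Fin k → ℚ) → ℚ
sumℚ {zero}  f = ℚ.0ℚ
sumℚ {suc k} f = f zero ℚ.+ sumℚ (λ i → f (suc i))

-- ℚ/ℤ, represented by ℚ with equality modulo ℤ.

IsInt : ℚ → Set
IsInt q = ∃ λ (z : ℤ) → q ≡ z / 1

_≡ℚ/ℤ_ : ℚ → ℚ → Set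
p ≡ℚ/ℤ q = IsInt (p ℚ.- q)

-- A character G → ℚ/ℤ, i.e. an element of G^∨ = Hom(G, ℚ/ℤ),
-- given by a lift f : G → ℚ.
IsCharacter : (G : FinGroup) → (Fin (FinGroup.N G) → ℚ) → Set
IsCharacter G f = ∀ g h → f (g ∙ h) ≡ℚ/ℤ (f g ℚ.+ f h)
  where open FinGroup G

-- The permutation module ℤ[G/H], realised as functions φ : G → ℤ
-- constant on left cosets gH (φ ↔ Σ_{gH} φ(g)·gH), with G acting by
-- (σ·φ)(g) = φ(σ⁻¹ g).  The norm element d (sum of all cosets) is the
-- constant function 1.

module Lattice (G : FinGroup) {k : ℕ} (H : Fin (suc k) → Subgroup G) where
  open FinGroup G

  -- Underlying data of an element of ⊕_i ℤ[G/G^(i)].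
  Pre : Set
  Pre = Fin (suc k) → Fin N → ℤ

  WF : Pre → Set
  WF φ = ∀ i g h → Subgroup.mem (H i) h → φ i (g ∙ h) ≡ φ i g

  -- Λ = (⊕_i ℤ[G/G^(i)]) / {(λ_1 d_1, …, λ_n d_n) : Σ λ_i = 0}
  -- Equality in Λ.
  _≈Λ_ : Pre → Pre → Set
  φ ≈Λ ψ = Σ (Fin (suc k) → ℤ) λ lam →
             (sumℤ lam ≡ ℤ.0ℤ) × (∀ i g → φ i g ≡ ψ i g ℤ.+ lam i)

  _+Λ_ : Pre → Pre → Pre
  (φ +Λ ψ) i g = φ i g ℤ.+ ψ i g

  -Λ_ : Pre → Pre
  (-Λ φ) i g = ℤ.- φ i g

  act : Fin N → Pre → Pre
  act σ φ i g = φ i ((σ ⁻¹) ∙ g)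

  -- The injection ℤ → Λ, 1 ↦ class of (d_1, 0, …, 0).
  ι : ℤ → Pre
  ι m zero    g = m
  ι m (suc i) g = ℤ.0ℤ

  IsCoboundary : (Fin N → Fin N → Pre) → Set
  IsCoboundary c =
    Σ (Fin N → Pre) λ a →
      (∀ g → WF (a g)) ×
      (∀ g h → c g h ≈Λ ((act g (a h) +Λ (-Λ a (g ∙ h))) +Λ a g))

{-# OPTIONS --safe #-}
-- Write δ for inhomogeneous coboundaries and suppose ι(δf) = δa for a 1-cochain a with values in Λ.
-- Componentwise, δa_i(g, h) is a multiple μ_i(g, h)·d_i of the norm element, with Σ_i μ_i = δf.
-- Averaging, f_i(g) = |G|⁻¹ Σ_x a_i(g)(x) satisfies δf_i = μ_i, so f_i is a character; evaluating
-- δa_i(g, h) at x = ε and at x = g and summing over g shows that f_i is integral on G^(i); and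
-- f − Σ_i f_i is a homomorphism G → ℚ, hence zero.
-- Conversely, given f ≡ Σ_i f_i, replace f_i by f̃_i = f_i ∘ rep, where rep y is a canonical element
-- among those y′ with f_i y′ ≡ f_i y mod ℤ. Since f_i vanishes on G^(i), f̃_i is exactly invariant
-- under left multiplication by G^(i), so a_i(g)(x) = δf̃_i(x⁻¹, g) is an integral cochain with values
-- in ℤ[G/G^(i)], and the cocycle identity gives δa_i(g, h) = δf̃_i(g, h)·d_i. The integral defect
-- f − Σ_i f̃_i is put into the first component, through ι.

module Submission where

open import Defs
open import Data.Nat using (ℕ; suc)
open import Data.Fin using (Fin)
open import Data.Integer using (ℤ)
open import Data.Rational using (ℚ; _+_; _-_; _/_; 0ℚ)
open import Data.Product using (Σ; _×_)
open import Relation.Binary.PropositionalEquality using (_≡_)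
open import Function.Bundles using (_⇔_)

open import Algebra.Bundles using (CommutativeRing; Group)
import Algebra.Properties.Group as GroupProperties
import Algebra.Properties.Ring as RingProperties
import Algebra.Properties.Semiring.Sum as SemiringSum
open import Data.Bool using (if_then_else_)
open import Data.Fin using (zero; suc)
open import Data.Fin.Permutation using (Permutation; permutation; _⟨$⟩ʳ_)
open import Data.Fin.Properties using (nonZeroIndex)
import Data.Integer as ℤ
open import Data.Integer using (+_; 0ℤ; 1ℤ)
import Data.Integer.GCD as ℤGCD
import Data.Integer.Properties as ℤP
import Data.Integer.Tactic.RingSolver as ℤ-Solver
import Data.Maybe as Maybe
open import Data.Maybe using (Maybe; just; nothing; fromMaybe)
import Data.Nat as ℕ
open import Data.Nat using (zero)
open import Data.Product using (∃; _,_; proj₁; proj₂)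
import Data.Rational as ℚ
open import Data.Rational using (1ℚ; ↥_; toℚᵘ)
import Data.Rational.Properties as ℚP
open import Data.Rational.Unnormalised using (mkℚᵘ; *≡*)
  renaming (_≃_ to _≃ᵘ_; _/_ to _/ᵘ_; _+_ to _+ᵘ_; -_ to -ᵘ_)
import Data.Rational.Unnormalised.Properties as ℚᵘP
open import Function.Base using (_∘_)
open import Function.Bundles using (mk⇔)
open import Level using (0ℓ)
import Relation.Binary.Construct.On as On
open import Relation.Binary.Core using (Rel)
open import Relation.Binary.PropositionalEquality
  using (refl; sym; trans; cong; cong₂; subst; _≗_; isEquivalence; module ≡-Reasoning)
open import Relation.Binary.Structures using (IsEquivalence; IsDecEquivalence)
open import Relation.Nullary using (Dec; yes; no; does; contradiction)
open import Relation.Nullary.Decidable using (map′; does-⇔; dec⇒maybe)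
open import Relation.Unary using (Pred; Decidable)
open import Tactic.RingSolver using (solve-∀)
open import Tactic.RingSolver.Core.AlmostCommutativeRing
  using (AlmostCommutativeRing; fromCommutativeRing)

ℚ-ring : AlmostCommutativeRing 0ℓ 0ℓ
ℚ-ring = fromCommutativeRing ℚP.+-*-commutativeRing (λ x → dec⇒maybe (0ℚ ℚP.≟ x))

fromℤ : ℤ → ℚ
fromℤ z = z / 1

↥-fromℤ : ∀ z → ↥ (fromℤ z) ≡ z
↥-fromℤ z = begin
  ↥ (fromℤ z)                       ≡⟨ ℤP.*-identityʳ _ ⟨
  ↥ (fromℤ z) ℤ.* 1ℤ                ≡⟨ cong (↥ (fromℤ z) ℤ.*_) (ℤGCD.gcd-zeroʳ z) ⟨
  ↥ (fromℤ z) ℤ.* ℤGCD.gcd z 1ℤ     ≡⟨ ℚP.↥-/ z 1 ⟩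
  z                                 ∎
  where open ≡-Reasoning

fromℤ-injective : ∀ {a b} → fromℤ a ≡ fromℤ b → a ≡ b
fromℤ-injective {a} {b} eq = trans (sym (↥-fromℤ a)) (trans (cong ↥_ eq) (↥-fromℤ b))

fromℤ-nonZero : ∀ n .{{_ : ℕ.NonZero n}} → ℚ.NonZero (fromℤ (+ n))
fromℤ-nonZero (suc m) = ℚ.≢-nonZero (λ eq → contradiction (fromℤ-injective {+ suc m} {0ℤ} eq) λ ())

toℚᵘ-/ : ∀ z d .{{_ : ℕ.NonZero d}} → toℚᵘ (z / d) ≃ᵘ z /ᵘ d
toℚᵘ-/ z (suc m) = ℚP.toℚᵘ-fromℚᵘ (mkℚᵘ z m)

/-distribʳ-+ : ∀ a b d .{{_ : ℕ.NonZero d}} → (a ℤ.+ b) / d ≡ a / d + b / d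
/-distribʳ-+ a b d@(suc _) = ℚP.toℚᵘ-injective (begin
  toℚᵘ ((a ℤ.+ b) / d)              ≈⟨ toℚᵘ-/ (a ℤ.+ b) d ⟩
  (a ℤ.+ b) /ᵘ d                    ≈⟨ *≡* cross-multiplied ⟩
  a /ᵘ d +ᵘ b /ᵘ d                  ≈⟨ ℚᵘP.+-cong (toℚᵘ-/ a d) (toℚᵘ-/ b d) ⟨
  toℚᵘ (a / d) +ᵘ toℚᵘ (b / d)      ≈⟨ ℚP.toℚᵘ-homo-+ (a / d) (b / d) ⟨
  toℚᵘ (a / d + b / d)              ∎)
  where
  open ℚᵘP.≃-Reasoning
  identity : ∀ a b d → (a ℤ.+ b) ℤ.* (d ℤ.* d) ≡ (a ℤ.* d ℤ.+ b ℤ.* d) ℤ.* d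
  identity = ℤ-Solver.solve-∀
  cross-multiplied : (a ℤ.+ b) ℤ.* + (d ℕ.* d) ≡ (a ℤ.* + d ℤ.+ b ℤ.* + d) ℤ.* + d
  cross-multiplied = trans (cong ((a ℤ.+ b) ℤ.*_) (ℤP.pos-* d d)) (identity a b (+ d))

/-neg : ∀ a d .{{_ : ℕ.NonZero d}} → (ℤ.- a) / d ≡ ℚ.- (a / d)
/-neg a d@(suc _) = ℚP.toℚᵘ-injective (begin
  toℚᵘ ((ℤ.- a) / d)    ≈⟨ toℚᵘ-/ (ℤ.- a) d ⟩
  -ᵘ (a /ᵘ d)           ≈⟨ ℚᵘP.-‿cong (toℚᵘ-/ a d) ⟨
  -ᵘ toℚᵘ (a / d)       ≈⟨ ℚP.toℚᵘ-homo‿- (a / d) ⟨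
  toℚᵘ (ℚ.- (a / d))    ∎)
  where open ℚᵘP.≃-Reasoning

/-linear : ∀ a b c d .{{_ : ℕ.NonZero d}} → (a ℤ.- b ℤ.+ c) / d ≡ a / d - b / d + c / d
/-linear a b c d = trans (/-distribʳ-+ (a ℤ.- b) c d)
  (cong (_+ c / d) (trans (/-distribʳ-+ a (ℤ.- b) d) (cong (_+_ (a / d)) (/-neg b d))))

d*z/d≡z : ∀ d .{{_ : ℕ.NonZero d}} z → (+ d ℤ.* z) / d ≡ fromℤ z
d*z/d≡z d@(suc _) z = ℚP.toℚᵘ-injective (begin
  toℚᵘ ((+ d ℤ.* z) / d)  ≈⟨ toℚᵘ-/ (+ d ℤ.* z) d ⟩
  (+ d ℤ.* z) /ᵘ d        ≈⟨ *≡* (trans (ℤP.*-identityʳ _) (ℤP.*-comm (+ d) z)) ⟩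
  z /ᵘ 1                  ≈⟨ toℚᵘ-/ z 1 ⟨
  toℚᵘ (fromℤ z)          ∎)
  where open ℚᵘP.≃-Reasoning

n*x≡0⇒x≡0 : ∀ n .{{_ : ℕ.NonZero n}} {x} → fromℤ (+ n) ℚ.* x ≡ 0ℚ → x ≡ 0ℚ
n*x≡0⇒x≡0 n {x} nx≡0 = begin
  x                   ≡⟨ ℚP.*-identityˡ x ⟨
  1ℚ ℚ.* x            ≡⟨ cong (ℚ._* x) (ℚP.*-inverseˡ n′) ⟨
  ℚ.1/ n′ ℚ.* n′ ℚ.* x  ≡⟨ ℚP.*-assoc (ℚ.1/ n′) n′ x ⟩
  ℚ.1/ n′ ℚ.* (n′ ℚ.* x) ≡⟨ cong (ℚ.1/ n′ ℚ.*_) nx≡0 ⟩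
  ℚ.1/ n′ ℚ.* 0ℚ      ≡⟨ ℚP.*-zeroʳ (ℚ.1/ n′) ⟩
  0ℚ                  ∎
  where
  open ≡-Reasoning
  n′ = fromℤ (+ n)
  instance _ = fromℤ-nonZero n

isInt-+ : ∀ {p q} → IsInt p → IsInt q → IsInt (p + q)
isInt-+ (a , refl) (b , refl) = a ℤ.+ b , sym (/-distribʳ-+ a b 1)

isInt-neg : ∀ {p} → IsInt p → IsInt (ℚ.- p)
isInt-neg (a , refl) = ℤ.- a , sym (/-neg a 1)

isInt? : (q : ℚ) → Dec (IsInt q)
isInt? q = map′ (λ eq → ↥ q , sym eq) (λ { (z , refl) → cong fromℤ (↥-fromℤ z) })
  (fromℤ (↥ q) ℚP.≟ q)

isInt-resp-≡ℚ/ℤ : ∀ {p q} → p ≡ℚ/ℤ q → IsInt q → IsInt p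
isInt-resp-≡ℚ/ℤ {p} {q} p≡q q-int = subst IsInt (identity p q) (isInt-+ p≡q q-int)
  where
  identity : ∀ p q → p - q + q ≡ p
  identity = solve-∀ ℚ-ring

isInt⇒≡ℚ/ℤ0 : ∀ {p} → IsInt p → p ≡ℚ/ℤ 0ℚ
isInt⇒≡ℚ/ℤ0 {p} = subst IsInt (sym (identity p))
  where
  identity : ∀ p → p - 0ℚ ≡ p
  identity = solve-∀ ℚ-ring

≡ℚ/ℤ-isEquivalence : IsEquivalence _≡ℚ/ℤ_
≡ℚ/ℤ-isEquivalence = record
  { refl  = λ {p} → 0ℤ , ℚP.+-inverseʳ p
  ; sym   = λ {p} {q} p≡q → subst IsInt (negated p q) (isInt-neg p≡q)
  ; trans = λ {p} {q} {r} p≡q q≡r → subst IsInt (chained p q r) (isInt-+ p≡q q≡r)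
  }
  where
  negated : ∀ p q → ℚ.- (p - q) ≡ q - p
  negated = solve-∀ ℚ-ring
  chained : ∀ p q r → p - q + (q - r) ≡ p - r
  chained = solve-∀ ℚ-ring

≡ℚ/ℤ-isDecEquivalence : IsDecEquivalence _≡ℚ/ℤ_
≡ℚ/ℤ-isDecEquivalence = record
  { isEquivalence = ≡ℚ/ℤ-isEquivalence
  ; _≟_           = λ p q → isInt? (p - q)
  }

module ≡ℚ/ℤ = IsEquivalence ≡ℚ/ℤ-isEquivalence

≡ℚ/ℤ-+ : ∀ {p p′ q q′} → p ≡ℚ/ℤ p′ → q ≡ℚ/ℤ q′ → (p + q) ≡ℚ/ℤ (p′ + q′)
≡ℚ/ℤ-+ {p} {p′} {q} {q′} p≡p′ q≡q′ = subst IsInt (identity p p′ q q′) (isInt-+ p≡p′ q≡q′)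
  where
  identity : ∀ p p′ q q′ → p - p′ + (q - q′) ≡ p + q - (p′ + q′)
  identity = solve-∀ ℚ-ring

≡ℚ/ℤ-sum : ∀ {n} {f g : Fin n → ℚ} → (∀ i → f i ≡ℚ/ℤ g i) → sumℚ f ≡ℚ/ℤ sumℚ g
≡ℚ/ℤ-sum {zero}          _   = ≡ℚ/ℤ.refl {0ℚ}
≡ℚ/ℤ-sum {suc n} {f} {g} f≡g =
  ≡ℚ/ℤ-+ {f zero} {g zero} {sumℚ (f ∘ suc)} {sumℚ (g ∘ suc)} (f≡g zero) (≡ℚ/ℤ-sum (f≡g ∘ suc))

-- sumℤ and sumℚ have their own recursive definitions; ∑-zero and ∑-suc are what it takes to reuse
-- the library's lemmas about sum for both.
module FinSum {c ℓ} (R : CommutativeRing c ℓ)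
  (∑ : ∀ {n} → (Fin n → CommutativeRing.Carrier R) → CommutativeRing.Carrier R)
  (∑-zero : ∀ f → CommutativeRing._≈_ R (∑ {0} f) (CommutativeRing.0# R))
  (∑-suc : ∀ {n} f →
    CommutativeRing._≈_ R (∑ {suc n} f) (CommutativeRing._+_ R (f zero) (∑ (f ∘ suc))))
  where

  open CommutativeRing R
    using ( Carrier; _≈_; 0#; 1#; _*_; -_; +-cong; +-congˡ; +-congʳ; *-congʳ; *-identityˡ
          ; -‿cong; setoid; semiring; ring)
    renaming (_+_ to _⊕_; _-_ to _⊖_)
  open SemiringSum semiring
    using (sum; sum-cong-≋; ∑-distrib-+; sum-permute; *-distribˡ-sum; *-distribʳ-sum)
  open RingProperties ring using (-1*x≈-x)
  open import Relation.Binary.Reasoning.Setoid setoid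

  ∑≈sum : ∀ {n} (f : Fin n → Carrier) → ∑ f ≈ sum f
  ∑≈sum {zero}  f = ∑-zero f
  ∑≈sum {suc n} f = begin
    ∑ f                    ≈⟨ ∑-suc f ⟩
    f zero ⊕ ∑ (f ∘ suc)   ≈⟨ +-congˡ (∑≈sum (f ∘ suc)) ⟩
    sum f                  ∎

  ∑-cong : ∀ {n} {f g : Fin n → Carrier} → (∀ i → f i ≈ g i) → ∑ f ≈ ∑ g
  ∑-cong {f = f} {g} f≈g = begin
    ∑ f    ≈⟨ ∑≈sum f ⟩
    sum f  ≈⟨ sum-cong-≋ f≈g ⟩
    sum g  ≈⟨ ∑≈sum g ⟨
    ∑ g    ∎

  ∑-+ : ∀ {n} (f g : Fin n → Carrier) → ∑ (λ i → f i ⊕ g i) ≈ ∑ f ⊕ ∑ g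
  ∑-+ f g = begin
    ∑ (λ i → f i ⊕ g i)  ≈⟨ ∑≈sum _ ⟩
    sum (λ i → f i ⊕ g i) ≈⟨ ∑-distrib-+ f g ⟩
    sum f ⊕ sum g        ≈⟨ +-cong (∑≈sum f) (∑≈sum g) ⟨
    ∑ f ⊕ ∑ g            ∎

  ∑-neg : ∀ {n} (f : Fin n → Carrier) → ∑ (λ i → - f i) ≈ - ∑ f
  ∑-neg f = begin
    ∑ (λ i → - f i)          ≈⟨ ∑-cong (λ i → -1*x≈-x (f i)) ⟨
    ∑ (λ i → - 1# * f i)     ≈⟨ ∑≈sum _ ⟩
    sum (λ i → - 1# * f i)   ≈⟨ *-distribˡ-sum (- 1#) f ⟨
    - 1# * sum f             ≈⟨ -1*x≈-x (sum f) ⟩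
    - sum f                  ≈⟨ -‿cong (∑≈sum f) ⟨
    - ∑ f                    ∎

  ∑-δ : ∀ {n} (f g h : Fin n → Carrier) → ∑ (λ i → f i ⊖ g i ⊕ h i) ≈ ∑ f ⊖ ∑ g ⊕ ∑ h
  ∑-δ f g h = begin
    ∑ (λ i → f i ⊖ g i ⊕ h i)  ≈⟨ ∑-+ (λ i → f i ⊖ g i) h ⟩
    ∑ (λ i → f i ⊖ g i) ⊕ ∑ h  ≈⟨ +-congʳ (∑-+ f (λ i → - g i)) ⟩
    ∑ f ⊕ ∑ (λ i → - g i) ⊕ ∑ h ≈⟨ +-congʳ (+-congˡ (∑-neg g)) ⟩
    ∑ f ⊖ ∑ g ⊕ ∑ h            ∎

  ∑-const : ∀ {n} x → ∑ {n} (λ _ → x) ≈ ∑ {n} (λ _ → 1#) * x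
  ∑-const {n} x = begin
    ∑ (λ _ → x)                ≈⟨ ∑-cong (λ _ → *-identityˡ x) ⟨
    ∑ (λ _ → 1# * x)           ≈⟨ ∑≈sum _ ⟩
    sum {n} (λ _ → 1# * x)     ≈⟨ *-distribʳ-sum {n} x (λ _ → 1#) ⟨
    sum {n} (λ _ → 1#) * x     ≈⟨ *-congʳ (∑≈sum _) ⟨
    ∑ (λ _ → 1#) * x           ∎

  ∑-permute : ∀ {n} (f : Fin n → Carrier) (π : Permutation n n) → ∑ f ≈ ∑ (λ i → f (π ⟨$⟩ʳ i))
  ∑-permute f π = begin
    ∑ f                       ≈⟨ ∑≈sum f ⟩
    sum f                     ≈⟨ sum-permute f π ⟩
    sum (λ i → f (π ⟨$⟩ʳ i))  ≈⟨ ∑≈sum _ ⟨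
    ∑ (λ i → f (π ⟨$⟩ʳ i))    ∎

module Σℤ = FinSum ℤP.+-*-commutativeRing sumℤ (λ _ → refl) (λ _ → refl)
module Σℚ = FinSum ℚP.+-*-commutativeRing sumℚ (λ _ → refl) (λ _ → refl)

sumℤ-const : ∀ {n} z → sumℤ {n} (λ _ → z) ≡ + n ℤ.* z
sumℤ-const {n} z = trans (Σℤ.∑-const {n} z) (cong (ℤ._* z) (ones n))
  where
  ones : ∀ n → sumℤ {n} (λ _ → 1ℤ) ≡ + n
  ones zero    = refl
  ones (suc n) = cong (ℤ._+_ 1ℤ) (ones n)

sumℚ-/ : ∀ {n} (z : Fin n → ℤ) d .{{_ : ℕ.NonZero d}} → sumℚ (λ i → z i / d) ≡ sumℤ z / d
sumℚ-/ {zero}  z d = sym (ℚP.0/n≡0 d)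
sumℚ-/ {suc n} z d = trans (cong (_+_ (z zero / d)) (sumℚ-/ (z ∘ suc) d))
  (sym (/-distribʳ-+ (z zero) (sumℤ (z ∘ suc)) d))

sumℚ-const : ∀ {n} x → sumℚ {n} (λ _ → x) ≡ fromℤ (+ n) ℚ.* x
sumℚ-const {n} x = trans (Σℚ.∑-const {n} x)
  (cong (ℚ._* x) (trans (sumℚ-/ {n} (λ _ → 1ℤ) 1)
    (cong fromℤ (trans (sumℤ-const {n} 1ℤ) (ℤP.*-identityʳ (+ n))))))

firstIndex : ∀ {n p} {P : Pred (Fin n) p} → Decidable P → Maybe (Fin n)
firstIndex {zero}  P? = nothing
firstIndex {suc n} P? = if does (P? zero) then just zero else Maybe.map suc (firstIndex (P? ∘ suc))

firstIndex-cong : ∀ {n p q} {P : Pred (Fin n) p} {Q : Pred (Fin n) q}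
  (P? : Decidable P) (Q? : Decidable Q) →
  (∀ x → P x ⇔ Q x) → firstIndex P? ≡ firstIndex Q?
firstIndex-cong {zero}  P? Q? P⇔Q = refl
firstIndex-cong {suc n} P? Q? P⇔Q = cong₂ (λ b r → if b then just zero else r)
  (does-⇔ (P⇔Q zero) (P? zero) (Q? zero))
  (cong (Maybe.map suc) (firstIndex-cong (P? ∘ suc) (Q? ∘ suc) (P⇔Q ∘ suc)))

firstIndex-found : ∀ {n p} {P : Pred (Fin n) p} (P? : Decidable P) {y} → P y →
  ∃ λ y₀ → firstIndex P? ≡ just y₀ × P y₀
firstIndex-found {suc n} P? {y} Py with P? zero
... | yes P0 = zero , refl , P0
firstIndex-found {suc n} P? {zero}  Py | no ¬P0 = contradiction Py ¬P0
firstIndex-found {suc n} P? {suc y} Py | no _ =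
  let y₀ , found , Py₀ = firstIndex-found (P? ∘ suc) Py in suc y₀ , cong (Maybe.map suc) found , Py₀

module CanonicalRepresentative {n ℓ} {_~_ : Rel (Fin n) ℓ} (~-isDecEquivalence : IsDecEquivalence _~_) where

  open IsDecEquivalence ~-isDecEquivalence renaming (refl to ~-refl; sym to ~-sym; trans to ~-trans)

  rep : Fin n → Fin n
  rep y = fromMaybe y (firstIndex (_≟ y))

  rep-~ : ∀ y → rep y ~ y
  rep-~ y with firstIndex-found (_≟ y) (~-refl {y})
  ... | y₀ , found , y₀~y rewrite found = y₀~y

  rep-cong : ∀ {y y′} → y ~ y′ → rep y ≡ rep y′
  rep-cong {y} {y′} y~y′ with firstIndex-found (_≟ y) (~-refl {y})
  ... | y₀ , found , _ = trans (cong (fromMaybe y) found) (sym (cong (fromMaybe y′) found′))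
    where
    found′ : firstIndex (_≟ y′) ≡ just y₀
    found′ = trans (sym (firstIndex-cong (_≟ y) (_≟ y′)
      (λ x → mk⇔ (λ x~y → ~-trans x~y y~y′) (λ x~y′ → ~-trans x~y′ (~-sym y~y′))))) found

toGroup : FinGroup → Group 0ℓ 0ℓ
toGroup G = record
  { Carrier = Fin N
  ; _≈_     = _≡_
  ; _∙_     = _∙_
  ; ε       = ε
  ; _⁻¹     = _⁻¹
  ; isGroup = record
    { isMonoid = record
      { isSemigroup = record
        { isMagma = record { isEquivalence = isEquivalence ; ∙-cong = cong₂ _∙_ }
        ; assoc   = assoc
        }
      ; identity = identityˡ , identityʳ
      }
    ; inverse = inverseˡ , inverseʳ
    ; ⁻¹-cong = cong _⁻¹
    }
  }
  where open FinGroup G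

module _ (G : FinGroup) where

  open FinGroup G
  open GroupProperties (toGroup G)
    using ( ⁻¹-involutive; ⁻¹-anti-homo-∙
          ; \\-leftDividesˡ; \\-leftDividesʳ; //-rightDividesˡ; //-rightDividesʳ)

  instance
    N-nonZero : ℕ.NonZero N
    N-nonZero = nonZeroIndex ε

  translateˡ : Fin N → Permutation N N
  translateˡ g = permutation (g ∙_) (g ⁻¹ ∙_) (\\-leftDividesˡ g) (\\-leftDividesʳ g)

  translateʳ : Fin N → Permutation N N
  translateʳ g = permutation (_∙ g) (_∙ g ⁻¹) (//-rightDividesˡ g) (//-rightDividesʳ g)

  inversion : Permutation N N
  inversion = permutation _⁻¹ _⁻¹ ⁻¹-involutive ⁻¹-involutive

  -- Inhomogeneous coboundaries in the convention of Lattice.IsCoboundary. In δₚ the coefficients are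
  -- functions G → ℤ acted on by (σ·φ)(x) = φ(σ⁻¹x): it is one component of the coboundary in Λ.
  δℤ : (Fin N → ℤ) → Fin N → Fin N → ℤ
  δℤ A g h = A h ℤ.- A (g ∙ h) ℤ.+ A g

  δℚ : (Fin N → ℚ) → Fin N → Fin N → ℚ
  δℚ F g h = F h - F (g ∙ h) + F g

  δₚ : (Fin N → Fin N → ℤ) → Fin N → Fin N → Fin N → ℤ
  δₚ b g h x = b h (g ⁻¹ ∙ x) ℤ.- b (g ∙ h) x ℤ.+ b g x

  δℚ-cong : ∀ {F F′} → F ≗ F′ → ∀ g h → δℚ F g h ≡ δℚ F′ g h
  δℚ-cong F≗F′ g h = cong₂ _+_ (cong₂ _-_ (F≗F′ h) (F≗F′ (g ∙ h))) (F≗F′ g)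

  δℚ-/ : ∀ (A : Fin N → ℤ) d .{{_ : ℕ.NonZero d}} g h → δℚ (λ x → A x / d) g h ≡ δℤ A g h / d
  δℚ-/ A d g h = sym (/-linear (A h) (A (g ∙ h)) (A g) d)

  δℚ-sub : ∀ F F′ g h → δℚ (λ x → F x - F′ x) g h ≡ δℚ F g h - δℚ F′ g h
  δℚ-sub F F′ g h = identity (F h) (F (g ∙ h)) (F g) (F′ h) (F′ (g ∙ h)) (F′ g)
    where
    identity : ∀ a b c a′ b′ c′ → a - a′ - (b - b′) + (c - c′) ≡ a - b + c - (a′ - b′ + c′)
    identity = solve-∀ ℚ-ring

  δℚ-∑ : ∀ {k} (F : Fin k → Fin N → ℚ) g h →
    δℚ (λ x → sumℚ (λ i → F i x)) g h ≡ sumℚ (λ i → δℚ (F i) g h)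
  δℚ-∑ F g h = sym (Σℚ.∑-δ (λ i → F i h) (λ i → F i (g ∙ h)) (λ i → F i g))

  δℚ-cocycle : ∀ F u g h → δℚ F (u ∙ g) h - δℚ F u (g ∙ h) + δℚ F u g ≡ δℚ F g h
  δℚ-cocycle F u g h = begin
    δℚ F (u ∙ g) h - δℚ F u (g ∙ h) + δℚ F u g
      ≡⟨ cong (λ y → F h - F y + F (u ∙ g) - δℚ F u (g ∙ h) + δℚ F u g) (assoc u g h) ⟩
    F h - F (u ∙ (g ∙ h)) + F (u ∙ g) - (F (g ∙ h) - F (u ∙ (g ∙ h)) + F u) + (F g - F (u ∙ g) + F u)
      ≡⟨ identity (F h) (F (u ∙ (g ∙ h))) (F (u ∙ g)) (F (g ∙ h)) (F u) (F g) ⟩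
    δℚ F g h ∎
    where
    open ≡-Reasoning
    identity : ∀ a b c d e f → a - b + c - (d - b + e) + (f - c + e) ≡ a - d + f
    identity = solve-∀ ℚ-ring

  δℚ-invariantˡ : ∀ {F k} → (∀ y → F (k ∙ y) ≡ F y) → ∀ u g → δℚ F (k ∙ u) g ≡ δℚ F u g
  δℚ-invariantˡ {F} {k} F-invariant u g =
    cong₂ _+_ (cong (_-_ (F g)) (trans (cong F (assoc k u g)) (F-invariant (u ∙ g)))) (F-invariant u)

  δℚ-cong-ℚ/ℤ : ∀ {F F′} → (∀ x → F x ≡ℚ/ℤ F′ x) → ∀ g h → δℚ F g h ≡ℚ/ℤ δℚ F′ g h
  δℚ-cong-ℚ/ℤ {F} {F′} F≡F′ g h =
    subst IsInt (identity (F h) (F (g ∙ h)) (F g) (F′ h) (F′ (g ∙ h)) (F′ g))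
      (isInt-+ (isInt-+ (F≡F′ h) (isInt-neg (F≡F′ (g ∙ h)))) (F≡F′ g))
    where
    identity : ∀ a b c a′ b′ c′ → a - a′ + ℚ.- (b - b′) + (c - c′) ≡ a - b + c - (a′ - b′ + c′)
    identity = solve-∀ ℚ-ring

  character⇒δ-integral : ∀ {F} → IsCharacter G F → ∀ g h → IsInt (δℚ F g h)
  character⇒δ-integral {F} F-character g h =
    subst IsInt (identity (F g) (F h) (F (g ∙ h))) (isInt-neg (F-character g h))
    where
    identity : ∀ a b c → ℚ.- (c - (a + b)) ≡ b - c + a
    identity = solve-∀ ℚ-ring

  δ-integral⇒character : ∀ {F} → (∀ g h → IsInt (δℚ F g h)) → IsCharacter G F
  δ-integral⇒character {F} δF-integral g h =
    subst IsInt (identity (F g) (F h) (F (g ∙ h))) (isInt-neg (δF-integral g h))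
    where
    identity : ∀ a b c → ℚ.- (b - c + a) ≡ c - (a + b)
    identity = solve-∀ ℚ-ring

  δℚ≡0⇒≡0 : ∀ F → (∀ g h → δℚ F g h ≡ 0ℚ) → ∀ g → F g ≡ 0ℚ
  δℚ≡0⇒≡0 F δF≡0 g = n*x≡0⇒x≡0 N (begin
    fromℤ (+ N) ℚ.* F g                      ≡⟨ sumℚ-const {N} (F g) ⟨
    N·Fg                                     ≡⟨ identity (sumℚ F) N·Fg ⟩
    sumℚ F - sumℚ F + N·Fg                   ≡⟨ cong (λ s → sumℚ F - s + N·Fg)
                                                     (Σℚ.∑-permute F (translateˡ g)) ⟩
    sumℚ F - sumℚ (λ h → F (g ∙ h)) + N·Fg   ≡⟨ Σℚ.∑-δ F (λ h → F (g ∙ h)) (λ _ → F g) ⟨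
    sumℚ (δℚ F g)                            ≡⟨ Σℚ.∑-cong (δF≡0 g) ⟩
    sumℚ {N} (λ _ → 0ℚ)                      ≡⟨ sumℚ-const {N} 0ℚ ⟩
    fromℤ (+ N) ℚ.* 0ℚ                       ≡⟨ ℚP.*-zeroʳ (fromℤ (+ N)) ⟩
    0ℚ                                       ∎)
    where
    open ≡-Reasoning
    N·Fg = sumℚ {N} (λ _ → F g)
    identity : ∀ s t → t ≡ s - s + t
    identity = solve-∀ ℚ-ring

  module Averaging (H : Subgroup G) (a : Fin N → Fin N → ℤ)
    (a-invariant : ∀ g x {h} → Subgroup.mem H h → a g (x ∙ h) ≡ a g x)
    (μ : Fin N → Fin N → ℤ) (δₚa≡μ : ∀ g h x → δₚ a g h x ≡ μ g h)
    where

    open ≡-Reasoning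

    A : Fin N → ℤ
    A g = sumℤ (a g)

    private
      cancel : ∀ x s → x ≡ x ℤ.- s ℤ.+ s
      cancel = ℤ-Solver.solve-∀

    δA≡N*μ : ∀ g h → δℤ A g h ≡ + N ℤ.* μ g h
    δA≡N*μ g h = begin
      A h ℤ.- A (g ∙ h) ℤ.+ A g
        ≡⟨ cong (λ s → s ℤ.- A (g ∙ h) ℤ.+ A g) (Σℤ.∑-permute (a h) (translateˡ (g ⁻¹))) ⟩
      sumℤ (λ x → a h (g ⁻¹ ∙ x)) ℤ.- A (g ∙ h) ℤ.+ A g
        ≡⟨ Σℤ.∑-δ (λ x → a h (g ⁻¹ ∙ x)) (a (g ∙ h)) (a g) ⟨
      sumℤ (δₚ a g h)
        ≡⟨ Σℤ.∑-cong (δₚa≡μ g h) ⟩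
      sumℤ {N} (λ _ → μ g h)
        ≡⟨ sumℤ-const {N} (μ g h) ⟩
      + N ℤ.* μ g h ∎

    A≡∑μ : ∀ h → A h ≡ sumℤ (λ g → μ g h)
    A≡∑μ h = begin
      A h
        ≡⟨ cancel (A h) S ⟩
      A h ℤ.- S ℤ.+ S
        ≡⟨ cong₂ (λ s t → s ℤ.- t ℤ.+ S)
             (Σℤ.∑-permute (a h) inversion) (Σℤ.∑-permute (λ g → a g ε) (translateʳ h)) ⟩
      sumℤ (λ g → a h (g ⁻¹)) ℤ.- sumℤ (λ g → a (g ∙ h) ε) ℤ.+ S
        ≡⟨ cong (λ s → s ℤ.- sumℤ (λ g → a (g ∙ h) ε) ℤ.+ S)
             (Σℤ.∑-cong (λ g → cong (a h) (sym (identityʳ (g ⁻¹))))) ⟩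
      sumℤ (λ g → a h (g ⁻¹ ∙ ε)) ℤ.- sumℤ (λ g → a (g ∙ h) ε) ℤ.+ S
        ≡⟨ Σℤ.∑-δ (λ g → a h (g ⁻¹ ∙ ε)) (λ g → a (g ∙ h) ε) (λ g → a g ε) ⟨
      sumℤ (λ g → δₚ a g h ε)
        ≡⟨ Σℤ.∑-cong (λ g → δₚa≡μ g h ε) ⟩
      sumℤ (λ g → μ g h) ∎
      where S = sumℤ (λ g → a g ε)

    N*a≡∑μ : ∀ {h} → Subgroup.mem H h → + N ℤ.* a h ε ≡ sumℤ (λ g → μ g h)
    N*a≡∑μ {h} h∈H = begin
      + N ℤ.* a h ε
        ≡⟨ cancel (+ N ℤ.* a h ε) T ⟩
      + N ℤ.* a h ε ℤ.- T ℤ.+ T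
        ≡⟨ cong₂ (λ s t → s ℤ.- t ℤ.+ T)
             (sumℤ-const {N} (a h ε)) (sym (Σℤ.∑-permute (λ g → a g g) (translateʳ h))) ⟨
      sumℤ {N} (λ _ → a h ε) ℤ.- sumℤ (λ g → a (g ∙ h) (g ∙ h)) ℤ.+ T
        ≡⟨ cong₂ (λ s t → s ℤ.- t ℤ.+ T)
             (Σℤ.∑-cong (λ g → cong (a h) (sym (inverseˡ g)))) (Σℤ.∑-cong (λ g → a-invariant (g ∙ h) g h∈H)) ⟩
      sumℤ (λ g → a h (g ⁻¹ ∙ g)) ℤ.- sumℤ (λ g → a (g ∙ h) g) ℤ.+ T
        ≡⟨ Σℤ.∑-δ (λ g → a h (g ⁻¹ ∙ g)) (λ g → a (g ∙ h) g) (λ g → a g g) ⟨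
      sumℤ (λ g → δₚ a g h g)
        ≡⟨ Σℤ.∑-cong (λ g → δₚa≡μ g h g) ⟩
      sumℤ (λ g → μ g h) ∎
      where T = sumℤ (λ g → a g g)

    F : Fin N → ℚ
    F g = A g / N

    δF≡μ : ∀ g h → δℚ F g h ≡ fromℤ (μ g h)
    δF≡μ g h = begin
      δℚ F g h              ≡⟨ δℚ-/ A N g h ⟩
      δℤ A g h / N          ≡⟨ cong (_/ N) (δA≡N*μ g h) ⟩
      (+ N ℤ.* μ g h) / N   ≡⟨ d*z/d≡z N (μ g h) ⟩
      fromℤ (μ g h)         ∎

    F-integral-on-H : ∀ {h} → Subgroup.mem H h → F h ≡ fromℤ (a h ε)
    F-integral-on-H {h} h∈H = begin
      A h / N                ≡⟨ cong (_/ N) (trans (A≡∑μ h) (sym (N*a≡∑μ h∈H))) ⟩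
      (+ N ℤ.* a h ε) / N    ≡⟨ d*z/d≡z N (a h ε) ⟩
      fromℤ (a h ε)          ∎

  module InvariantLift (H : Subgroup G) (φ : Fin N → ℚ) (φ-character : IsCharacter G φ)
    (φ-vanishes : ∀ h → Subgroup.mem H h → φ h ≡ℚ/ℤ 0ℚ)
    where

    open CanonicalRepresentative (On.isDecEquivalence φ ≡ℚ/ℤ-isDecEquivalence)
    open ≡-Reasoning

    φ̃ : Fin N → ℚ
    φ̃ = φ ∘ rep

    φ̃≡φ : ∀ y → φ̃ y ≡ℚ/ℤ φ y
    φ̃≡φ = rep-~

    φ̃-invariant : ∀ {k} → Subgroup.mem H k → ∀ y → φ̃ (k ∙ y) ≡ φ̃ y
    φ̃-invariant {k} k∈H y = cong φ (rep-cong φky≡φy)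
      where
      identity : ∀ a b c → a - (b + c) + (b - 0ℚ) ≡ a - c
      identity = solve-∀ ℚ-ring
      φky≡φy : φ (k ∙ y) ≡ℚ/ℤ φ y
      φky≡φy = subst IsInt (identity (φ (k ∙ y)) (φ k) (φ y))
        (isInt-+ (φ-character k y) (φ-vanishes k k∈H))

    δφ̃-integral : ∀ x g → IsInt (δℚ φ̃ x g)
    δφ̃-integral x g =
      isInt-resp-≡ℚ/ℤ (δℚ-cong-ℚ/ℤ {φ̃} {φ} φ̃≡φ x g) (character⇒δ-integral {φ} φ-character x g)

    opaque
      C : Fin N → Fin N → ℤ
      C x g = proj₁ (δφ̃-integral x g)

      C-spec : ∀ x g → δℚ φ̃ x g ≡ fromℤ (C x g)
      C-spec x g = proj₂ (δφ̃-integral x g)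

    b : Fin N → Fin N → ℤ
    b g x = C (x ⁻¹) g

    b-invariant : ∀ g x {k} → Subgroup.mem H k → b g (x ∙ k) ≡ b g x
    b-invariant g x {k} k∈H = fromℤ-injective (begin
      fromℤ (C ((x ∙ k) ⁻¹) g)   ≡⟨ C-spec ((x ∙ k) ⁻¹) g ⟨
      δℚ φ̃ ((x ∙ k) ⁻¹) g        ≡⟨ cong (λ u → δℚ φ̃ u g) (⁻¹-anti-homo-∙ x k) ⟩
      δℚ φ̃ (k ⁻¹ ∙ x ⁻¹) g       ≡⟨ δℚ-invariantˡ (φ̃-invariant (Subgroup.⁻¹-mem H k∈H)) (x ⁻¹) g ⟩
      δℚ φ̃ (x ⁻¹) g              ≡⟨ C-spec (x ⁻¹) g ⟩
      fromℤ (C (x ⁻¹) g)         ∎)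

    δₚb≡C : ∀ g h x → δₚ b g h x ≡ C g h
    δₚb≡C g h x = fromℤ-injective (begin
      fromℤ (C ((g ⁻¹ ∙ x) ⁻¹) h ℤ.- C u (g ∙ h) ℤ.+ C u g)
        ≡⟨ /-linear (C ((g ⁻¹ ∙ x) ⁻¹) h) (C u (g ∙ h)) (C u g) 1 ⟩
      fromℤ (C ((g ⁻¹ ∙ x) ⁻¹) h) - fromℤ (C u (g ∙ h)) + fromℤ (C u g)
        ≡⟨ cong₂ _+_ (cong₂ _-_ (C-spec ((g ⁻¹ ∙ x) ⁻¹) h) (C-spec u (g ∙ h))) (C-spec u g) ⟨
      δℚ φ̃ ((g ⁻¹ ∙ x) ⁻¹) h - δℚ φ̃ u (g ∙ h) + δℚ φ̃ u g
        ≡⟨ cong (λ v → δℚ φ̃ v h - δℚ φ̃ u (g ∙ h) + δℚ φ̃ u g) [g⁻¹x]⁻¹≡x⁻¹g ⟩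
      δℚ φ̃ (u ∙ g) h - δℚ φ̃ u (g ∙ h) + δℚ φ̃ u g
        ≡⟨ δℚ-cocycle φ̃ u g h ⟩
      δℚ φ̃ g h
        ≡⟨ C-spec g h ⟩
      fromℤ (C g h) ∎)
      where
      u = x ⁻¹
      [g⁻¹x]⁻¹≡x⁻¹g : (g ⁻¹ ∙ x) ⁻¹ ≡ u ∙ g
      [g⁻¹x]⁻¹≡x⁻¹g = trans (⁻¹-anti-homo-∙ (g ⁻¹) x) (cong (u ∙_) (⁻¹-involutive g))

  IsSumOfCharactersVanishingOn : ∀ {k} → (Fin (suc k) → Subgroup G) → (Fin N → ℚ) → Set
  IsSumOfCharactersVanishingOn {k} H f = Σ (Fin (suc k) → Fin N → ℚ) λ fs →
    (∀ i → IsCharacter G (fs i))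
    × (∀ i h → Subgroup.mem (H i) h → fs i h ≡ℚ/ℤ 0ℚ)
    × (∀ g → f g ≡ℚ/ℤ sumℚ (λ i → fs i g))

  module _ {k} (H : Fin (suc k) → Subgroup G) where

    open Lattice G H

    ι-const : ∀ m i x y → ι m i x ≡ ι m i y
    ι-const m zero    x y = refl
    ι-const m (suc i) x y = refl

    ∑-ι : ∀ m x → sumℤ (λ i → ι m i x) ≡ m
    ∑-ι m x = trans (cong (ℤ._+_ m) (trans (sumℤ-const {k} 0ℤ) (ℤP.*-zeroʳ (+ k)))) (ℤP.+-identityʳ m)

    ι-linear : ∀ m m′ m″ i x y z w → ι m i x ℤ.- ι m′ i y ℤ.+ ι m″ i z ≡ ι (m ℤ.- m′ ℤ.+ m″) i w
    ι-linear m m′ m″ zero    x y z w = refl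
    ι-linear m m′ m″ (suc i) x y z w = refl

    -- An element of Λ with constant components D i is Σ_i D i · d_i; ι m is the class of those with
    -- Σ_i D i = m.
    ι≈Λ⇒normCombination : ∀ {m ψ} → ι m ≈Λ ψ →
      ∃ λ (D : Fin (suc k) → ℤ) → (∀ i x → ψ i x ≡ D i) × sumℤ D ≡ m
    ι≈Λ⇒normCombination {m} {ψ} (lam , ∑lam≡0 , ι≡ψ+lam) = D , ψ≡D , ∑D≡m
      where
      D : Fin (suc k) → ℤ
      D i = ι m i ε ℤ.- lam i
      shift : ∀ p q → p ≡ p ℤ.+ q ℤ.- q
      shift = ℤ-Solver.solve-∀
      ψ≡D : ∀ i x → ψ i x ≡ D i
      ψ≡D i x = trans (shift (ψ i x) (lam i))
        (cong (ℤ._- lam i) (trans (sym (ι≡ψ+lam i x)) (ι-const m i x ε)))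
      ∑D≡m : sumℤ D ≡ m
      ∑D≡m = begin
        sumℤ D                                             ≡⟨ Σℤ.∑-+ (λ i → ι m i ε) (λ i → ℤ.- lam i) ⟩
        sumℤ (λ i → ι m i ε) ℤ.+ sumℤ (λ i → ℤ.- lam i)    ≡⟨ cong₂ ℤ._+_ (∑-ι m ε) (Σℤ.∑-neg lam) ⟩
        m ℤ.- sumℤ lam                                     ≡⟨ cong (ℤ._-_ m) ∑lam≡0 ⟩
        m ℤ.- 0ℤ                                           ≡⟨ ℤP.+-identityʳ m ⟩
        m                                                  ∎
        where open ≡-Reasoning

    normCombination⇒ι≈Λ : ∀ {m ψ} (D : Fin (suc k) → ℤ) → (∀ i x → ψ i x ≡ D i) → sumℤ D ≡ m → ι m ≈Λ ψ
    normCombination⇒ι≈Λ {m} {ψ} D ψ≡D ∑D≡m = lam , ∑lam≡0 , ι≡ψ+lam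
      where
      lam : Fin (suc k) → ℤ
      lam i = ι m i ε ℤ.- D i
      unshift : ∀ p q → p ≡ q ℤ.+ (p ℤ.- q)
      unshift = ℤ-Solver.solve-∀
      ι≡ψ+lam : ∀ i x → ι m i x ≡ ψ i x ℤ.+ lam i
      ι≡ψ+lam i x =
        trans (ι-const m i x ε) (trans (unshift (ι m i ε) (D i)) (cong (ℤ._+ lam i) (sym (ψ≡D i x))))
      ∑lam≡0 : sumℤ lam ≡ 0ℤ
      ∑lam≡0 = begin
        sumℤ lam                                        ≡⟨ Σℤ.∑-+ (λ i → ι m i ε) (λ i → ℤ.- D i) ⟩
        sumℤ (λ i → ι m i ε) ℤ.+ sumℤ (λ i → ℤ.- D i)   ≡⟨ cong₂ ℤ._+_ (∑-ι m ε) (Σℤ.∑-neg D) ⟩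
        m ℤ.- sumℤ D                                    ≡⟨ cong (ℤ._-_ m) ∑D≡m ⟩
        m ℤ.- m                                         ≡⟨ ℤP.+-inverseʳ m ⟩
        0ℤ                                              ∎
        where open ≡-Reasoning

    module CoboundaryToCharacters (f : Fin N → ℚ) (c : Fin N → Fin N → ℤ)
      (δf≡c : ∀ g h → δℚ f g h ≡ fromℤ (c g h))
      (a : Fin N → Pre) (a-wf : ∀ g → WF (a g))
      (ι≈δa : ∀ g h → ι (c g h) ≈Λ ((act g (a h) +Λ (-Λ a (g ∙ h))) +Λ a g))
      where

      δa-normCombination : ∀ g h →
        ∃ λ (D : Fin (suc k) → ℤ) → (∀ i x → δₚ (λ g x → a g i x) g h x ≡ D i) × sumℤ D ≡ c g h
      δa-normCombination g h = ι≈Λ⇒normCombination (ι≈δa g h)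

      μ : Fin (suc k) → Fin N → Fin N → ℤ
      μ i g h = proj₁ (δa-normCombination g h) i

      module Avg (i : Fin (suc k)) =
        Averaging (H i) (λ g x → a g i x) (λ g x {h} → a-wf g i x h)
          (μ i) (λ g h x → proj₁ (proj₂ (δa-normCombination g h)) i x)

      F : Fin (suc k) → Fin N → ℚ
      F = Avg.F

      F-character : ∀ i → IsCharacter G (F i)
      F-character i = δ-integral⇒character {F i} (λ g h → μ i g h , Avg.δF≡μ i g h)

      F-vanishes : ∀ i h → Subgroup.mem (H i) h → F i h ≡ℚ/ℤ 0ℚ
      F-vanishes i h h∈H = isInt⇒≡ℚ/ℤ0 (a h i ε , Avg.F-integral-on-H i h∈H)

      δ[f-∑F]≡0 : ∀ g h → δℚ (λ x → f x - sumℚ (λ i → F i x)) g h ≡ 0ℚ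
      δ[f-∑F]≡0 g h = begin
        δℚ (λ x → f x - sumℚ (λ i → F i x)) g h        ≡⟨ δℚ-sub f (λ x → sumℚ (λ i → F i x)) g h ⟩
        δℚ f g h - δℚ (λ x → sumℚ (λ i → F i x)) g h    ≡⟨ cong₂ _-_ (δf≡c g h) (δℚ-∑ F g h) ⟩
        fromℤ (c g h) - sumℚ (λ i → δℚ (F i) g h)       ≡⟨ cong (_-_ (fromℤ (c g h))) ∑δF≡∑μ ⟩
        fromℤ (c g h) - fromℤ (sumℤ (λ i → μ i g h))    ≡⟨ cong (λ t → fromℤ (c g h) - fromℤ t)
                                                               (proj₂ (proj₂ (δa-normCombination g h))) ⟩
        fromℤ (c g h) - fromℤ (c g h)                   ≡⟨ ℚP.+-inverseʳ (fromℤ (c g h)) ⟩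
        0ℚ                                              ∎
        where
        open ≡-Reasoning
        ∑δF≡∑μ : sumℚ (λ i → δℚ (F i) g h) ≡ fromℤ (sumℤ (λ i → μ i g h))
        ∑δF≡∑μ = trans (Σℚ.∑-cong (λ i → Avg.δF≡μ i g h)) (sumℚ-/ (λ i → μ i g h) 1)

      f≡∑F : ∀ g → f g ≡ℚ/ℤ sumℚ (λ i → F i g)
      f≡∑F g = 0ℤ , δℚ≡0⇒≡0 (λ x → f x - sumℚ (λ i → F i x)) δ[f-∑F]≡0 g

    module CharactersToCoboundary (f : Fin N → ℚ) (c : Fin N → Fin N → ℤ)
      (δf≡c : ∀ g h → δℚ f g h ≡ fromℤ (c g h))
      (φ : Fin (suc k) → Fin N → ℚ) (φ-character : ∀ i → IsCharacter G (φ i))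
      (φ-vanishes : ∀ i h → Subgroup.mem (H i) h → φ i h ≡ℚ/ℤ 0ℚ)
      (f≡∑φ : ∀ g → f g ≡ℚ/ℤ sumℚ (λ i → φ i g))
      where

      module L (i : Fin (suc k)) = InvariantLift (H i) (φ i) (φ-character i) (φ-vanishes i)

      Φ : Fin N → ℚ
      Φ x = sumℚ (λ i → L.φ̃ i x)

      f≡Φ : ∀ x → f x ≡ℚ/ℤ Φ x
      f≡Φ x = ≡ℚ/ℤ.trans {f x} {sumℚ (λ i → φ i x)} {Φ x} (f≡∑φ x)
        (≡ℚ/ℤ-sum {f = λ i → φ i x} {g = λ i → L.φ̃ i x} (λ i → ≡ℚ/ℤ.sym {L.φ̃ i x} {φ i x} (L.φ̃≡φ i x)))

      n : Fin N → ℤ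
      n x = proj₁ (f≡Φ x)

      a : Fin N → Pre
      a g i x = L.b i g x ℤ.+ ι (n g) i x

      a-wf : ∀ g → WF (a g)
      a-wf g i x h h∈H = cong₂ ℤ._+_ (L.b-invariant i g x h∈H) (ι-const (n g) i (x ∙ h) x)

      ∑C+δn≡c : ∀ g h → sumℤ (λ i → L.C i g h) ℤ.+ δℤ n g h ≡ c g h
      ∑C+δn≡c g h = fromℤ-injective (begin
        fromℤ (sumℤ (λ i → L.C i g h) ℤ.+ δℤ n g h)
          ≡⟨ /-distribʳ-+ (sumℤ (λ i → L.C i g h)) (δℤ n g h) 1 ⟩
        fromℤ (sumℤ (λ i → L.C i g h)) + fromℤ (δℤ n g h)
          ≡⟨ cong₂ _+_ (sumℚ-/ (λ i → L.C i g h) 1) (δℚ-/ n 1 g h) ⟨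
        sumℚ (λ i → fromℤ (L.C i g h)) + δℚ (fromℤ ∘ n) g h
          ≡⟨ cong₂ _+_ (Σℚ.∑-cong (λ i → L.C-spec i g h)) (δℚ-cong (λ x → proj₂ (f≡Φ x)) g h) ⟨
        sumℚ (λ i → δℚ (L.φ̃ i) g h) + δℚ (λ x → f x - Φ x) g h
          ≡⟨ cong₂ _+_ (sym (δℚ-∑ L.φ̃ g h)) (δℚ-sub f Φ g h) ⟩
        δℚ Φ g h + (δℚ f g h - δℚ Φ g h)
          ≡⟨ identity (δℚ Φ g h) (δℚ f g h) ⟩
        δℚ f g h
          ≡⟨ δf≡c g h ⟩
        fromℤ (c g h) ∎)
        where
        open ≡-Reasoning
        identity : ∀ p q → p + (q - p) ≡ q
        identity = solve-∀ ℚ-ring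

      δₚa≡C+ι : ∀ g h i x → δₚ (λ g x → a g i x) g h x ≡ L.C i g h ℤ.+ ι (δℤ n g h) i ε
      δₚa≡C+ι g h i x =
        trans (regroup (L.b i h y) (ι (n h) i y) (L.b i (g ∙ h) x) (ι (n (g ∙ h)) i x)
                       (L.b i g x) (ι (n g) i x))
          (cong₂ ℤ._+_ (L.δₚb≡C i g h x) (ι-linear (n h) (n (g ∙ h)) (n g) i y x x ε))
        where
        y = g ⁻¹ ∙ x
        regroup : ∀ b₁ ι₁ b₂ ι₂ b₃ ι₃ →
          b₁ ℤ.+ ι₁ ℤ.- (b₂ ℤ.+ ι₂) ℤ.+ (b₃ ℤ.+ ι₃) ≡ b₁ ℤ.- b₂ ℤ.+ b₃ ℤ.+ (ι₁ ℤ.- ι₂ ℤ.+ ι₃)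
        regroup = ℤ-Solver.solve-∀

      ι≈δa : ∀ g h → ι (c g h) ≈Λ ((act g (a h) +Λ (-Λ a (g ∙ h))) +Λ a g)
      ι≈δa g h = normCombination⇒ι≈Λ (λ i → L.C i g h ℤ.+ ι (δℤ n g h) i ε) (δₚa≡C+ι g h) (begin
        sumℤ (λ i → L.C i g h ℤ.+ ι (δℤ n g h) i ε)
          ≡⟨ Σℤ.∑-+ (λ i → L.C i g h) (λ i → ι (δℤ n g h) i ε) ⟩
        sumℤ (λ i → L.C i g h) ℤ.+ sumℤ (λ i → ι (δℤ n g h) i ε)
          ≡⟨ cong (ℤ._+_ (sumℤ (λ i → L.C i g h))) (∑-ι (δℤ n g h) ε) ⟩
        sumℤ (λ i → L.C i g h) ℤ.+ δℤ n g h
          ≡⟨ ∑C+δn≡c g h ⟩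
        c g h ∎)
        where open ≡-Reasoning

    coboundary⇒sumOfCharacters : ∀ (f : Fin N → ℚ) (c : Fin N → Fin N → ℤ) →
      (∀ g h → δℚ f g h ≡ fromℤ (c g h)) → IsCoboundary (λ g h → ι (c g h)) → IsSumOfCharactersVanishingOn H f
    coboundary⇒sumOfCharacters f c δf≡c (a , a-wf , ι≈δa) = F , F-character , F-vanishes , f≡∑F
      where open CoboundaryToCharacters f c δf≡c a a-wf ι≈δa

    sumOfCharacters⇒coboundary : ∀ (f : Fin N → ℚ) (c : Fin N → Fin N → ℤ) →
      (∀ g h → δℚ f g h ≡ fromℤ (c g h)) → IsSumOfCharactersVanishingOn H f → IsCoboundary (λ g h → ι (c g h))
    sumOfCharacters⇒coboundary f c δf≡c (φ , φ-character , φ-vanishes , f≡∑φ) = a , a-wf , ι≈δa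
      where open CharactersToCoboundary f c δf≡c φ φ-character φ-vanishes f≡∑φ

mainTheorem18 :
  (G : FinGroup) (k : ℕ) (H : Fin (suc k) → Subgroup G) →
  -- L is the Galois closure of L_1⋯L_n : the G^(i) have trivial common core
  (∀ g → (∀ i σ → Subgroup.mem (H i) (FinGroup._∙_ G (FinGroup._∙_ G (FinGroup._⁻¹ G σ) g) σ)) → g ≡ FinGroup.ε G) →
  -- f ∈ G^∨ with lift f : G → ℚ, and c = δf the corresponding integral 2-cocycle,
  -- i.e. the image of f under G^∨ ≅ H¹(G,ℚ/ℤ) ≅ H²(G,ℤ)
  (f : Fin (FinGroup.N G) → ℚ) → IsCharacter G f →
  (c : Fin (FinGroup.N G) → Fin (FinGroup.N G) → ℤ) →
  (∀ g h → (f g + f h) - f (FinGroup._∙_ G g h) ≡ c g h / 1) →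
  -- e(δf) = 0 in H²(G,Λ)  ⇔  f = Σ f_i with f_i ∈ G^∨, f_i|_{G^(i)} ≡ 0
  (Lattice.IsCoboundary G H (λ g h → Lattice.ι G H (c g h))
    ⇔ Σ (Fin (suc k) → Fin (FinGroup.N G) → ℚ) (λ fs →
        (∀ i → IsCharacter G (fs i))
        × (∀ i h → Subgroup.mem (H i) h → fs i h ≡ℚ/ℤ 0ℚ)
        × (∀ g → f g ≡ℚ/ℤ sumℚ (λ i → fs i g))))
mainTheorem18 G k H _ f _ c hc =
  mk⇔ (coboundary⇒sumOfCharacters G H f c δf≡c) (sumOfCharacters⇒coboundary G H f c δf≡c)
  where
  identity : ∀ a b c → b - c + a ≡ a + b - c
  identity = solve-∀ ℚ-ring
  δf≡c : ∀ g h → δℚ G f g h ≡ fromℤ (c g h)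
  δf≡c g h = trans (identity (f g) (f h) (f (FinGroup._∙_ G g h))) (hc g h)
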